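{- Let $G=(V,E)$ be a finite, strongly connected directed multigraph with $n=\#V$ and let $s\in V$. Then \[\mathrm{Rec}(G,s)/\langle\gamma_s\rangle\;\cong\;K(G,s)/\langle\overline{\beta_s}\rangle\;\cong\;\mathbb{Z}^n_0/\Delta\mathbb{Z}^n.\]
   Context: Identify $V$ with $\{1,\dots,n\}$. $d_{vw}$ is the number of directed edges from $v$ to $w$, $d_v$ the outdegree of $v$. The (total) Laplacian is the $n\times n$ matrix with $\Delta_{vw}=-d_{wv}$ for $v\ne w$ and $\Delta_{vv}=d_v-d_{vv}$; $\Delta\mathbb{Z}^n$ is its integer column span, and $\mathbb{Z}^n_0$ is the set of integer vectors with coordinate sum $0$. $\Delta_s$ is $\Delta$ with the row and column of $s$ deleted; $K(G,s)=\mathbb{Z}^{n-1}/\Delta_s\mathbb{Z}^{n-1}$ (coordinates indexed by $V\setminus\{s\}$). $\beta_s\in\mathbb{Z}^{n-1}$ is $\beta_s(v)=d_{sv}$ and $\overline{\beta_s}$ its class in $K(G,s)$. A sandpile is $\eta\in\mathbb{Z}^{n-1}$ (indexed by nonsink vertices); it is stable if $\eta(v)<d_v$ for all $v\neq s$; a nonsink vertex $v$ with $\eta(v)\ge d_v$ may fire, replacing $\eta$ by $\eta-\Delta_s\delta_v$. Every sandpile reaches a stable sandpile by such firings, which is independent of the order; call it the stabilization $\eta^\circ$. A sandpile $\eta$ is accessible if from any sandpile one can obtain $\eta$ by adding a nonnegative number of grains at each nonsink vertex and then firing active nonsink vertices; recurrent means stable and accessible. $\mathrm{Rec}(G,s)$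 is the set of recurrent sandpiles, a group under $\eta\oplus\xi=(\eta+\xi)^\circ$, isomorphic to $K(G,s)$ via inclusion. $e_s$ denotes its identity (the unique recurrent sandpile in $\Delta_s\mathbb{Z}^{n-1}$), and $\gamma_s=(e_s+\beta_s)^\circ$. -}

module Defs where

open import Data.Nat as ℕ using (ℕ; zero; suc)
open import Data.Integer as ℤ using (ℤ; +_; _+_; _-_; _*_; -_)
open import Data.Fin using (Fin; zero; suc; punchIn)
open import Data.Product using (Σ; ∃; _×_; _,_)
open import Data.Sum using (_⊎_)
open import Relation.Binary.PropositionalEquality using (_≡_)
open import Relation.Nullary using (¬_; yes; no)
open import Data.Fin using (_≟_)

Σℕ : ∀ {k} → (Fin k → ℕ) → ℕ
Σℕ {zero}  f = 0
Σℕ {suc k} f = f zero ℕ.+ Σℕ (λ i → f (suc i))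

Σℤ : ∀ {k} → (Fin k → ℤ) → ℤ
Σℤ {zero}  f = + 0
Σℤ {suc k} f = f zero + Σℤ (λ i → f (suc i))

-- A finite directed multigraph on vertex set Fin n is given by
-- d v w = number of directed edges from v to w (loops allowed).
Multigraph : ℕ → Set
Multigraph n = Fin n → Fin n → ℕ

data Path {n} (d : Multigraph n) : Fin n → Fin n → Set where
  here : ∀ {v} → Path d v v
  step : ∀ {u v w} → ℕ._<_ 0 (d u v) → Path d v w → Path d u w

StronglyConnected : ∀ {n} → Multigraph n → Set
StronglyConnected d = ∀ v w → Path d v w

outdeg : ∀ {n} → Multigraph n → Fin n → ℕ
outdeg d v = Σℕ (d v)

Lap : ∀ {n} → Multigraph n → Fin n → Fin n → ℤ
Lap d v w with v ≟ w
... | yes _ = + outdeg d v - + d v v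
... | no  _ = - (+ d w v)

InSpan : ∀ {k l} → (Fin k → Fin l → ℤ) → (Fin k → ℤ) → Set
InSpan {k} {l} M x = Σ (Fin l → ℤ) λ c → ∀ i → x i ≡ Σℤ (λ j → M i j * c j)

-- group-level isomorphism of setoid-presented quotients:
-- f respects the relations, reflects them, and is surjective up to ≈
record IsQuotBij {A B : Set} (_~_ : A → A → Set) (_≈_ : B → B → Set)
                 (f : A → B) : Set where
  field
    wd   : ∀ x y → x ~ y → f x ≈ f y
    inj  : ∀ x y → f x ≈ f y → x ~ y
    surj : ∀ y → Σ A λ x → f x ≈ y

module Total {n} (d : Multigraph n) where
  Z0 : Set
  Z0 = Σ (Fin n → ℤ) λ x → Σℤ x ≡ + 0

  _≈Δ_ : (Fin n → ℤ) → (Fin n → ℤ) → Set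
  x ≈Δ y = InSpan (Lap d) (λ i → x i - y i)

  _≈Z0_ : Z0 → Z0 → Set
  (x , _) ≈Z0 (y , _) = x ≈Δ y

-- Sandpile notions, with n = suc m vertices and sink s;
-- nonsink vertices are indexed by Fin m via punchIn s.
module Sandpile {m} (d : Multigraph (suc m)) (s : Fin (suc m)) where
  V' : Fin m → Fin (suc m)
  V' = punchIn s

  Lap_s : Fin m → Fin m → ℤ
  Lap_s i j = Lap d (V' i) (V' j)

  Config : Set
  Config = Fin m → ℤ

  _⊞_ : Config → Config → Config
  (x ⊞ y) i = x i + y i

  _≈K_ : Config → Config → Set
  x ≈K y = InSpan Lap_s (λ i → x i - y i)

  β : Config
  β i = + d s (V' i)

  _≈Kβ_ : Config → Config → Set
  x ≈Kβ y = Σ ℤ λ k → InSpan Lap_s (λ i → (x i - y i) - k * β i)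

  fire : Fin m → Config → Config
  fire v η i = η i - Lap_s i v

  Active : Config → Fin m → Set
  Active η v = + outdeg d (V' v) ℤ.≤ η v

  Stable : Config → Set
  Stable η = ∀ v → η v ℤ.< + outdeg d (V' v)

  data Reach : Config → Config → Set where
    done : ∀ {η ξ} → (∀ i → η i ≡ ξ i) → Reach η ξ
    step : ∀ {η ξ} v → Active η v → Reach (fire v η) ξ → Reach η ξ

  Stab : Config → Config → Set
  Stab η ξ = Reach η ξ × Stable ξ

  Accessible : Config → Set
  Accessible η = ∀ (σ : Config) → Σ (Fin m → ℕ) λ c →
                   Reach (λ i → σ i + + c i) η

  Recurrent : Config → Set
  Recurrent η = Stable η × Accessible η

  Rec : Set
  Rec = Σ Config Recurrent

  IsGamma : Config → Set
  IsGamma γ = Σ Config λ e → Recurrent e × InSpan Lap_s e × Stab (e ⊞ β) γ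

  data AddPow (γ : Config) : ℕ → Config → Config → Set where
    pow0 : ∀ {η ζ} → (∀ i → η i ≡ ζ i) → AddPow γ zero η ζ
    powS : ∀ {k η η' ζ} → Stab (η ⊞ γ) η' → AddPow γ k η' ζ →
           AddPow γ (suc k) η ζ

  _~γ_[_] : Rec → Rec → Config → Set
  (η , _) ~γ (ξ , _) [ γ ] = Σ ℕ λ k → AddPow γ k ξ η ⊎ AddPow γ k η ξ

module Submission where

-- The second isomorphism is linear algebra: extending x ∈ ℤ^{n-1} by -Σx at
-- the sink identifies ℤ^{n-1} with ℤ^n_0, and modulo Δℤ^n the extra column
-- of the sink in Δ contributes exactly the multiples of β_s.
--
-- The first is induced by the inclusion Rec ⊆ ℤ^{n-1}, and rests on the basic
-- theory of sandpiles, developed from the definitions: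
--  * odometers and the least action principle give unique stabilizations;
--  * strong connectivity bounds the odometer along a path to the sink, so
--    every nonnegative configuration stabilizes;
--  * a positive vector ε ∈ Δ_s ℕ^{n-1} is absorbed by every recurrent
--    configuration; hence each class of K(G,s) has exactly one recurrent element;
--  * γ_s ≡ β_s in K(G,s), so adding γ_s k times adds kβ_s.

open import Defs
open import Data.Nat as ℕ using (ℕ; zero; suc)
import Data.Nat.Properties as ℕP
open import Data.Integer as ℤ using (ℤ; +_; _+_; _-_; _*_; -_; _≤_; _<_)
import Data.Integer.Properties as ℤP
open import Data.Integer.Tactic.RingSolver using (solve-∀)
open import Data.Fin using (Fin; zero; suc; punchIn; punchOut; _≟_)
import Data.Fin.Properties as FinP
open import Data.Fin.Properties using (any?)
open import Data.Product using (Σ; _×_; _,_; proj₁; proj₂)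
open import Data.Sum using (inj₁; inj₂)
open import Function using (_∘_)
open import Relation.Binary.PropositionalEquality
  using (_≡_; _≢_; _≗_; refl; sym; trans; cong; cong₂; subst; module ≡-Reasoning)
open import Relation.Nullary using (yes; no)
open import Data.Empty using (⊥-elim)
open import Algebra.Bundles using (AbelianGroup)
import Algebra.Properties.Semiring.Sum as SemiringSum
open import Algebra.Properties.Group (AbelianGroup.group ℤP.+-0-abelianGroup)
  using () renaming (inverseˡ-unique to ℤ-inverseˡ-unique)
open import Algebra.Properties.CommutativeSemigroup ℕP.+-commutativeSemigroup
  using () renaming (interchange to ℕ+-interchange)

module ∑ℤ = SemiringSum ℤP.+-*-semiring

Σℤ≡sum : ∀ {k} (f : Fin k → ℤ) → Σℤ f ≡ ∑ℤ.sum f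
Σℤ≡sum {zero}  f = refl
Σℤ≡sum {suc k} f = cong (λ x → f zero + x) (Σℤ≡sum (f ∘ suc))

Σℤ-cong : ∀ {k} {f g : Fin k → ℤ} → (∀ i → f i ≡ g i) → Σℤ f ≡ Σℤ g
Σℤ-cong {zero}  e = refl
Σℤ-cong {suc k} e = cong₂ _+_ (e zero) (Σℤ-cong (e ∘ suc))

Σℤ-0 : ∀ {k} → Σℤ {k} (λ _ → + 0) ≡ + 0
Σℤ-0 {k} = trans (Σℤ≡sum {k} (λ _ → + 0)) (∑ℤ.sum-replicate-zero k)

Σℤ-+ : ∀ {k} (f g : Fin k → ℤ) → Σℤ (λ i → f i + g i) ≡ Σℤ f + Σℤ g
Σℤ-+ f g = begin
  Σℤ (λ i → f i + g i)      ≡⟨ Σℤ≡sum (λ i → f i + g i) ⟩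
  ∑ℤ.sum (λ i → f i + g i)  ≡⟨ ∑ℤ.∑-distrib-+ f g ⟩
  ∑ℤ.sum f + ∑ℤ.sum g       ≡⟨ cong₂ _+_ (Σℤ≡sum f) (Σℤ≡sum g) ⟨
  Σℤ f + Σℤ g               ∎
  where open ≡-Reasoning

Σℤ-*ˡ : ∀ {k} (a : ℤ) (f : Fin k → ℤ) → Σℤ (λ i → a * f i) ≡ a * Σℤ f
Σℤ-*ˡ a f = begin
  Σℤ (λ i → a * f i)      ≡⟨ Σℤ≡sum (λ i → a * f i) ⟩
  ∑ℤ.sum (λ i → a * f i)  ≡⟨ ∑ℤ.*-distribˡ-sum a f ⟨
  a * ∑ℤ.sum f            ≡⟨ cong (λ x → a * x) (Σℤ≡sum f) ⟨
  a * Σℤ f                ∎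
  where open ≡-Reasoning

Σℤ-*ʳ : ∀ {k} (f : Fin k → ℤ) (a : ℤ) → Σℤ (λ i → f i * a) ≡ Σℤ f * a
Σℤ-*ʳ f a = trans (Σℤ-cong (λ i → ℤP.*-comm (f i) a)) (trans (Σℤ-*ˡ a f) (ℤP.*-comm a (Σℤ f)))

Σℤ-neg : ∀ {k} (f : Fin k → ℤ) → Σℤ (λ i → - f i) ≡ - Σℤ f
Σℤ-neg f = begin
  Σℤ (λ i → - f i)          ≡⟨ Σℤ-cong (λ i → ℤP.-1*i≡-i (f i)) ⟨
  Σℤ (λ i → - + 1 * f i)    ≡⟨ Σℤ-*ˡ (- + 1) f ⟩
  - + 1 * Σℤ f              ≡⟨ ℤP.-1*i≡-i (Σℤ f) ⟩
  - Σℤ f                    ∎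
  where open ≡-Reasoning

Σℤ-- : ∀ {k} (f g : Fin k → ℤ) → Σℤ (λ i → f i - g i) ≡ Σℤ f - Σℤ g
Σℤ-- f g = trans (Σℤ-+ f (λ i → - g i)) (cong (λ x → Σℤ f + x) (Σℤ-neg g))

Σℤ-swap : ∀ {k l} (F : Fin k → Fin l → ℤ) →
  Σℤ (λ i → Σℤ (F i)) ≡ Σℤ (λ j → Σℤ (λ i → F i j))
Σℤ-swap F = begin
  Σℤ (λ i → Σℤ (F i))                     ≡⟨ trans (Σℤ≡sum (λ i → Σℤ (F i))) (∑ℤ.sum-cong-≗ (Σℤ≡sum ∘ F)) ⟩
  ∑ℤ.sum (λ i → ∑ℤ.sum (F i))             ≡⟨ ∑ℤ.∑-comm F ⟩
  ∑ℤ.sum (λ j → ∑ℤ.sum (λ i → F i j))     ≡⟨ trans (Σℤ≡sum (λ j → Σℤ (λ i → F i j))) (∑ℤ.sum-cong-≗ (λ j → Σℤ≡sum (λ i → F i j))) ⟨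
  Σℤ (λ j → Σℤ (λ i → F i j))             ∎
  where open ≡-Reasoning

Σℤ-split : ∀ {k} (s : Fin (suc k)) (f : Fin (suc k) → ℤ) →
  Σℤ f ≡ f s + Σℤ (f ∘ punchIn s)
Σℤ-split s f = begin
  Σℤ f                         ≡⟨ Σℤ≡sum f ⟩
  ∑ℤ.sum f                     ≡⟨ ∑ℤ.sum-remove {i = s} f ⟩
  f s + ∑ℤ.sum (f ∘ punchIn s) ≡⟨ cong (λ x → f s + x) (Σℤ≡sum (f ∘ punchIn s)) ⟨
  f s + Σℤ (f ∘ punchIn s)     ∎
  where open ≡-Reasoning

Σℤ-mono : ∀ {k} {f g : Fin k → ℤ} → (∀ i → f i ≤ g i) → Σℤ f ≤ Σℤ g
Σℤ-mono {zero}  h = ℤP.≤-refl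
Σℤ-mono {suc k} h = ℤP.+-mono-≤ (h zero) (Σℤ-mono (h ∘ suc))

Σℤ-nonneg : ∀ {k} {f : Fin k → ℤ} → (∀ i → + 0 ≤ f i) → + 0 ≤ Σℤ f
Σℤ-nonneg {k} {f} h = subst (_≤ Σℤ f) (Σℤ-0 {k}) (Σℤ-mono h)

Σℤ-nonpos : ∀ {k} {f : Fin k → ℤ} → (∀ i → f i ≤ + 0) → Σℤ f ≤ + 0
Σℤ-nonpos {k} {f} h = subst (Σℤ f ≤_) (Σℤ-0 {k}) (Σℤ-mono h)

term≤Σ : ∀ {k} (f : Fin k → ℤ) → (∀ i → + 0 ≤ f i) → ∀ j → f j ≤ Σℤ f
term≤Σ {suc k} f h j = begin
  f j                          ≤⟨ ℤP.i≤i+j (f j) (Σℤ (f ∘ punchIn j)) ⦃ ℤ.nonNegative (Σℤ-nonneg (h ∘ punchIn j)) ⦄ ⟩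
  f j + Σℤ (f ∘ punchIn j)     ≡⟨ Σℤ-split j f ⟨
  Σℤ f                         ∎
  where open ℤP.≤-Reasoning

term≤Σ-minus : ∀ {k} (f : Fin k → ℤ) (i j : Fin k) → i ≢ j →
  (∀ l → l ≢ i → + 0 ≤ f l) → f j ≤ Σℤ f - f i
term≤Σ-minus {suc k} f i j i≢j h = begin
  f j                                ≡⟨ cong f (FinP.punchIn-punchOut i≢j) ⟨
  f (punchIn i (punchOut i≢j))       ≤⟨ term≤Σ (f ∘ punchIn i) (λ l → h _ (FinP.punchInᵢ≢i i l)) (punchOut i≢j) ⟩
  Σℤ (f ∘ punchIn i)                 ≡⟨ cancel (f i) (Σℤ (f ∘ punchIn i)) ⟩
  (f i + Σℤ (f ∘ punchIn i)) - f i   ≡⟨ cong (_- f i) (Σℤ-split i f) ⟨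
  Σℤ f - f i                         ∎
  where
  open ℤP.≤-Reasoning
  cancel : ∀ a b → b ≡ (a + b) - a
  cancel = solve-∀

Σ≤term : ∀ {k} (f : Fin k → ℤ) (i : Fin k) →
  (∀ l → l ≢ i → f l ≤ + 0) → Σℤ f ≤ f i
Σ≤term {suc k} f i h = begin
  Σℤ f                         ≡⟨ Σℤ-split i f ⟩
  f i + Σℤ (f ∘ punchIn i)     ≤⟨ ℤP.+-monoʳ-≤ (f i) (Σℤ-nonpos (λ l → h _ (FinP.punchInᵢ≢i i l))) ⟩
  f i + + 0                    ≡⟨ ℤP.+-identityʳ (f i) ⟩
  f i                          ∎
  where open ℤP.≤-Reasoning

Σℕ-cast : ∀ {k} (f : Fin k → ℕ) → + Σℕ f ≡ Σℤ (λ i → + f i)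
Σℕ-cast {zero}  f = refl
Σℕ-cast {suc k} f = trans (ℤP.pos-+ (f zero) (Σℕ (f ∘ suc))) (cong (λ x → + f zero + x) (Σℕ-cast (f ∘ suc)))

Σℕ-mono : ∀ {k} {f g : Fin k → ℕ} → (∀ i → f i ℕ.≤ g i) → Σℕ f ℕ.≤ Σℕ g
Σℕ-mono {zero}  h = ℕ.z≤n
Σℕ-mono {suc k} h = ℕP.+-mono-≤ (h zero) (Σℕ-mono (h ∘ suc))

Σℕ-+ : ∀ {k} (f g : Fin k → ℕ) → Σℕ (λ i → f i ℕ.+ g i) ≡ Σℕ f ℕ.+ Σℕ g
Σℕ-+ {zero}  f g = refl
Σℕ-+ {suc k} f g = trans (cong (f zero ℕ.+ g zero ℕ.+_) (Σℕ-+ (f ∘ suc) (g ∘ suc)))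
                         (ℕ+-interchange (f zero) (g zero) (Σℕ (f ∘ suc)) (Σℕ (g ∘ suc)))

termℕ≤Σ : ∀ {k} (f : Fin k → ℕ) j → f j ℕ.≤ Σℕ f
termℕ≤Σ f zero    = ℕP.m≤m+n (f zero) _
termℕ≤Σ f (suc j) = ℕP.≤-trans (termℕ≤Σ (f ∘ suc) j) (ℕP.m≤n+m _ (f zero))

*-nonneg : ∀ {a b} → + 0 ≤ a → + 0 ≤ b → + 0 ≤ a * b
*-nonneg {a} {b} ha hb = subst (_≤ a * b) (ℤP.*-zeroʳ a) (ℤP.*-monoˡ-≤-nonNeg a ⦃ ℤ.nonNegative ha ⦄ hb)

*-nonpos : ∀ {a b} → a ≤ + 0 → + 0 ≤ b → a * b ≤ + 0
*-nonpos {a} {b} ha hb = subst (a * b ≤_) (ℤP.*-zeroˡ b) (ℤP.*-monoʳ-≤-nonNeg b ⦃ ℤ.nonNegative hb ⦄ ha)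

0≤+ : ∀ n → + 0 ≤ + n
0≤+ n = ℤ.+≤+ ℕ.z≤n

≤-+nonneg : ∀ a {b} → + 0 ≤ b → a ≤ a + b
≤-+nonneg a {b} hb = ℤP.i≤i+j a b ⦃ ℤ.nonNegative hb ⦄

nonneg-shift : ∀ {k} (x : Fin k → ℤ) (e : Fin k → ℕ) → (∀ i → 1 ℕ.≤ e i) →
  ∀ i → + 0 ≤ x i + + (Σℕ (λ j → ℤ.∣ x j ∣) ℕ.* e i)
nonneg-shift x e e≥1 i = begin
  + 0                   ≡⟨ ℤP.+-inverseʳ (x i) ⟨
  x i - x i             ≤⟨ ℤP.+-monoʳ-≤ (x i) (ℤP.≤-trans (-x≤∣x∣ (x i)) (ℤ.+≤+ ∣xi∣≤Ke)) ⟩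
  x i + + (K ℕ.* e i)   ∎
  where
  open ℤP.≤-Reasoning
  K : ℕ
  K = Σℕ (λ j → ℤ.∣ x j ∣)
  -x≤∣x∣ : ∀ a → - a ≤ + ℤ.∣ a ∣
  -x≤∣x∣ (+ zero)   = ℤP.≤-refl
  -x≤∣x∣ (+ suc n)  = ℤ.-≤+
  -x≤∣x∣ ℤ.-[1+ n ] = ℤP.≤-refl
  ∣xi∣≤Ke : ℤ.∣ x i ∣ ℕ.≤ K ℕ.* e i
  ∣xi∣≤Ke = ℕP.≤-trans (termℕ≤Σ (λ j → ℤ.∣ x j ∣) i) (ℕP.m≤m*n K (e i) ⦃ ℕ.>-nonZero (e≥1 i) ⦄)

δ : ∀ {k} → Fin k → Fin k → ℕ
δ v j with v ≟ j
... | yes _ = 1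
... | no  _ = 0

δ-self : ∀ {k} (v : Fin k) → δ v v ≡ 1
δ-self v with v ≟ v
... | yes _  = refl
... | no v≢v = ⊥-elim (v≢v refl)

δ-other : ∀ {k} (v j : Fin k) → v ≢ j → δ v j ≡ 0
δ-other v j v≢j with v ≟ j
... | yes v≡j = ⊥-elim (v≢j v≡j)
... | no  _   = refl

Σℤ-δ : ∀ {k} (f : Fin k → ℤ) (v : Fin k) → Σℤ (λ j → f j * + δ v j) ≡ f v
Σℤ-δ {suc k} f v = begin
  Σℤ (λ j → f j * + δ v j)                              ≡⟨ Σℤ-split v (λ j → f j * + δ v j) ⟩
  f v * + δ v v + Σℤ (λ l → f (punchIn v l) * + δ v (punchIn v l))
                                                        ≡⟨ cong₂ _+_ diag (trans (Σℤ-cong off) (Σℤ-0 {k})) ⟩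
  f v + + 0                                             ≡⟨ ℤP.+-identityʳ (f v) ⟩
  f v                                                   ∎
  where
  open ≡-Reasoning
  diag : f v * + δ v v ≡ f v
  diag = trans (cong (λ t → f v * + t) (δ-self v)) (ℤP.*-identityʳ (f v))
  off : ∀ l → f (punchIn v l) * + δ v (punchIn v l) ≡ + 0
  off l = trans (cong (λ t → f (punchIn v l) * + t) (δ-other v _ (FinP.punchInᵢ≢i v l ∘ sym)))
                (ℤP.*-zeroʳ (f (punchIn v l)))

Σℕ-δ : ∀ {k} (v : Fin k) → Σℕ (δ v) ≡ 1
Σℕ-δ v = ℤP.+-injective (begin
  + Σℕ (δ v)                  ≡⟨ Σℕ-cast (δ v) ⟩
  Σℤ (λ j → + δ v j)          ≡⟨ Σℤ-cong (λ j → ℤP.*-identityˡ (+ δ v j)) ⟨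
  Σℤ (λ j → + 1 * + δ v j)    ≡⟨ Σℤ-δ (λ _ → + 1) v ⟩
  + 1                         ∎)
  where open ≡-Reasoning

infixr 7 _⊛_
_⊛_ : ∀ {k l} → (Fin k → Fin l → ℤ) → (Fin l → ℤ) → Fin k → ℤ
(M ⊛ c) i = Σℤ (λ j → M i j * c j)

ι : ∀ {k} → (Fin k → ℕ) → Fin k → ℤ
ι w j = + w j

module _ {k l} (M : Fin k → Fin l → ℤ) where

  ⊛-cong : ∀ {c c'} → (∀ j → c j ≡ c' j) → ∀ i → (M ⊛ c) i ≡ (M ⊛ c') i
  ⊛-cong e i = Σℤ-cong (λ j → cong (M i j *_) (e j))

  ⊛-zero : ∀ i → (M ⊛ (λ _ → + 0)) i ≡ + 0
  ⊛-zero i = trans (Σℤ-cong (λ j → ℤP.*-zeroʳ (M i j))) (Σℤ-0 {l})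

  ⊛-+ : ∀ c c' i → (M ⊛ (λ j → c j + c' j)) i ≡ (M ⊛ c) i + (M ⊛ c') i
  ⊛-+ c c' i = trans (Σℤ-cong (λ j → ℤP.*-distribˡ-+ (M i j) (c j) (c' j)))
                      (Σℤ-+ (λ j → M i j * c j) (λ j → M i j * c' j))

  ⊛-scale : ∀ a c i → (M ⊛ (λ j → a * c j)) i ≡ a * (M ⊛ c) i
  ⊛-scale a c i = trans (Σℤ-cong (λ j → swap (M i j) a (c j))) (Σℤ-*ˡ a (λ j → M i j * c j))
    where
    swap : ∀ x y z → x * (y * z) ≡ y * (x * z)
    swap = solve-∀

  ⊛-neg : ∀ c i → (M ⊛ (λ j → - c j)) i ≡ - (M ⊛ c) i
  ⊛-neg c i = trans (Σℤ-cong (λ j → sym (ℤP.neg-distribʳ-* (M i j) (c j)))) (Σℤ-neg (λ j → M i j * c j))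

  ⊛-ι-+ : ∀ w w' i → (M ⊛ ι (λ j → w j ℕ.+ w' j)) i ≡ (M ⊛ ι w) i + (M ⊛ ι w') i
  ⊛-ι-+ w w' i = trans (⊛-cong (λ j → ℤP.pos-+ (w j) (w' j)) i) (⊛-+ (ι w) (ι w') i)

  ⊛-δ : ∀ v i → (M ⊛ ι (δ v)) i ≡ M i v
  ⊛-δ v i = Σℤ-δ (M i) v

  span-cong : ∀ {x y} → (∀ i → x i ≡ y i) → InSpan M x → InSpan M y
  span-cong e (c , h) = c , (λ i → trans (sym (e i)) (h i))

  span-0 : InSpan M (λ _ → + 0)
  span-0 = (λ _ → + 0) , (λ i → sym (⊛-zero i))

  span-+ : ∀ {x y} → InSpan M x → InSpan M y → InSpan M (λ i → x i + y i)
  span-+ (c , h) (c' , h') = (λ j → c j + c' j) , (λ i → trans (cong₂ _+_ (h i) (h' i)) (sym (⊛-+ c c' i)))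

  span-scale : ∀ {x} a → InSpan M x → InSpan M (λ i → a * x i)
  span-scale a (c , h) = (λ j → a * c j) , (λ i → trans (cong (a *_) (h i)) (sym (⊛-scale a c i)))

  span-neg : ∀ {x} → InSpan M x → InSpan M (λ i → - x i)
  span-neg (c , h) = (λ j → - c j) , (λ i → trans (cong -_ (h i)) (sym (⊛-neg c i)))

  span-⊛ : ∀ c → InSpan M (M ⊛ c)
  span-⊛ c = c , (λ i → refl)

module Laplacian {m} (d : Multigraph (suc m)) where

  Lap-diag : ∀ v → Lap d v v ≡ + outdeg d v - + d v v
  Lap-diag v with v ≟ v
  ... | yes _  = refl
  ... | no v≢v = ⊥-elim (v≢v refl)

  Lap-off : ∀ v w → v ≢ w → Lap d v w ≡ - (+ d w v)
  Lap-off v w v≢w with v ≟ w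
  ... | yes v≡w = ⊥-elim (v≢w v≡w)
  ... | no  _   = refl

  -- Firing w removes d_w grains from w and adds d_{wv} grains to each v.
  Lap-colsum : ∀ w → Σℤ (λ v → Lap d v w) ≡ + 0
  Lap-colsum w = begin
    Σℤ (λ v → Lap d v w)                                   ≡⟨ Σℤ-split w (λ v → Lap d v w) ⟩
    Lap d w w + Σℤ (λ k → Lap d (punchIn w k) w)           ≡⟨ cong₂ _+_ (Lap-diag w) (Σℤ-cong off) ⟩
    (+ outdeg d w - + d w w) + Σℤ (λ k → - + d w (punchIn w k))
                                                           ≡⟨ cong₂ (λ a b → (a - + d w w) + b) outdeg-split (Σℤ-neg (λ k → + d w (punchIn w k))) ⟩
    ((+ d w w + out) - + d w w) + - out                    ≡⟨ cancel (+ d w w) out ⟩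
    + 0                                                    ∎
    where
    open ≡-Reasoning
    out : ℤ
    out = Σℤ (λ k → + d w (punchIn w k))
    off : ∀ k → Lap d (punchIn w k) w ≡ - + d w (punchIn w k)
    off k = Lap-off (punchIn w k) w (FinP.punchInᵢ≢i w k)
    outdeg-split : + outdeg d w ≡ + d w w + out
    outdeg-split = trans (Σℕ-cast (d w)) (Σℤ-split w (λ v → + d w v))
    cancel : ∀ a b → ((a + b) - a) + - b ≡ + 0
    cancel = solve-∀

  Σ-Lap⊛ : ∀ C → Σℤ (Lap d ⊛ C) ≡ + 0
  Σ-Lap⊛ C = begin
    Σℤ (λ v → Σℤ (λ w → Lap d v w * C w))   ≡⟨ Σℤ-swap (λ v w → Lap d v w * C w) ⟩
    Σℤ (λ w → Σℤ (λ v → Lap d v w * C w))   ≡⟨ Σℤ-cong (λ w → Σℤ-*ʳ (λ v → Lap d v w) (C w)) ⟩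
    Σℤ (λ w → Σℤ (λ v → Lap d v w) * C w)   ≡⟨ Σℤ-cong (λ w → trans (cong (_* C w) (Lap-colsum w)) (ℤP.*-zeroˡ (C w))) ⟩
    Σℤ {suc m} (λ _ → + 0)                  ≡⟨ Σℤ-0 {suc m} ⟩
    + 0                                     ∎
    where open ≡-Reasoning

module SandpileTheory {m} (d : Multigraph (suc m)) (s : Fin (suc m)) where
  open Sandpile d s
  open Laplacian d

  V'≢s : ∀ i → V' i ≢ s
  V'≢s = FinP.punchInᵢ≢i s

  Lap_s-off : ∀ i j → i ≢ j → Lap_s i j ≡ - + d (V' j) (V' i)
  Lap_s-off i j i≢j = Lap-off (V' i) (V' j) (i≢j ∘ FinP.punchIn-injective s i j)

  Lap_s-off≤0 : ∀ i j → i ≢ j → Lap_s i j ≤ + 0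
  Lap_s-off≤0 i j i≢j = subst (_≤ + 0) (sym (Lap_s-off i j i≢j)) (ℤP.neg-mono-≤ (0≤+ _))

  -- Column j of Δ_s sums to d_{js}: firing j loses exactly d_{js} grains to the sink.
  Lap_s-colsum : ∀ j → Σℤ (λ i → Lap_s i j) ≡ + d (V' j) s
  Lap_s-colsum j = begin
    Σℤ (λ i → Lap_s i j)                                   ≡⟨ cancel ((Lap d) s (V' j)) _ ⟩
    ((Lap d) s (V' j) + Σℤ (λ i → Lap_s i j)) - (Lap d) s (V' j) ≡⟨ cong (_- (Lap d) s (V' j)) (Σℤ-split s (λ v → Lap d v (V' j))) ⟨
    Σℤ (λ v → Lap d v (V' j)) - (Lap d) s (V' j)             ≡⟨ cong₂ _-_ (Lap-colsum (V' j)) (Lap-off s (V' j) (V'≢s j ∘ sym)) ⟩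
    + 0 - - + d (V' j) s                                   ≡⟨ neg-neg (+ d (V' j) s) ⟩
    + d (V' j) s                                           ∎
    where
    open ≡-Reasoning
    cancel : ∀ a b → b ≡ (a + b) - a
    cancel = solve-∀
    neg-neg : ∀ a → + 0 - - a ≡ a
    neg-neg = solve-∀

  Nonneg : Config → Set
  Nonneg x = ∀ i → + 0 ≤ x i

  -- η ⊖ w is η after firing each nonsink vertex j exactly w_j times.
  infixl 6 _⊖_
  _⊖_ : Config → (Fin m → ℕ) → Config
  (η ⊖ w) i = η i - (Lap_s ⊛ ι w) i

  ⊖-zero : ∀ η → (η ⊖ (λ _ → 0)) ≗ η
  ⊖-zero η i = trans (cong (λ t → η i - t) (⊛-zero Lap_s i)) (ℤP.+-identityʳ (η i))

  ⊖-cong : ∀ η {w w'} → w ≗ w' → (η ⊖ w) ≗ (η ⊖ w')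
  ⊖-cong η e i = cong (λ t → η i - t) (⊛-cong Lap_s (cong +_ ∘ e) i)

  ⊖-fire : ∀ η w v → (η ⊖ (λ j → w j ℕ.+ δ v j)) ≗ (fire v η ⊖ w)
  ⊖-fire η w v i = begin
    η i - (Lap_s ⊛ ι (λ j → w j ℕ.+ δ v j)) i       ≡⟨ cong (λ t → η i - t) (⊛-ι-+ Lap_s w (δ v) i) ⟩
    η i - ((Lap_s ⊛ ι w) i + (Lap_s ⊛ ι (δ v)) i)   ≡⟨ cong (λ t → η i - ((Lap_s ⊛ ι w) i + t)) (⊛-δ Lap_s v i) ⟩
    η i - ((Lap_s ⊛ ι w) i + Lap_s i v)             ≡⟨ reorder (η i) _ (Lap_s i v) ⟩
    (η i - Lap_s i v) - (Lap_s ⊛ ι w) i             ∎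
    where
    open ≡-Reasoning
    reorder : ∀ a b c → a - (b + c) ≡ (a - c) - b
    reorder = solve-∀

  fire-⊖ : ∀ η w v → fire v (η ⊖ w) ≗ (fire v η ⊖ w)
  fire-⊖ η w v i = swap (η i) ((Lap_s ⊛ ι w) i) (Lap_s i v)
    where
    swap : ∀ a b c → (a - b) - c ≡ (a - c) - b
    swap = solve-∀

  Stable-cong : ∀ {ξ ξ'} → ξ ≗ ξ' → Stable ξ → Stable ξ'
  Stable-cong e st v = subst (_< _) (e v) (st v)

  Reach-congˡ : ∀ {η η' ξ} → η ≗ η' → Reach η ξ → Reach η' ξ
  Reach-congˡ e (done eq)      = done (λ i → trans (sym (e i)) (eq i))
  Reach-congˡ e (step v act r) =
    step v (subst (_ ≤_) (e v) act) (Reach-congˡ (λ i → cong (_- Lap_s i v) (e i)) r)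

  Reach-congʳ : ∀ {η ξ ξ'} → ξ ≗ ξ' → Reach η ξ → Reach η ξ'
  Reach-congʳ e (done eq)      = done (λ i → trans (eq i) (e i))
  Reach-congʳ e (step v act r) = step v act (Reach-congʳ e r)

  Reach-trans : ∀ {a b c} → Reach a b → Reach b c → Reach a c
  Reach-trans (done eq)      r' = Reach-congˡ (sym ∘ eq) r'
  Reach-trans (step v act r) r' = step v act (Reach-trans r r')

  Reach-shift : ∀ {η ξ} → Reach η ξ → (x : Fin m → ℕ) → Reach (λ i → η i + + x i) (λ i → ξ i + + x i)
  Reach-shift (done eq)          x = done (λ i → cong (_+ + x i) (eq i))
  Reach-shift {η} (step v act r) x =
    step v (ℤP.≤-trans act (≤-+nonneg (η v) (0≤+ (x v))))
      (Reach-congˡ (λ i → reorder (η i) (Lap_s i v) (+ x i)) (Reach-shift r x))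
    where
    reorder : ∀ a b c → (a - b) + c ≡ (a + c) - b
    reorder = solve-∀

  odometer : ∀ {η ξ} → Reach η ξ → Fin m → ℕ
  odometer (done _)       = λ _ → 0
  odometer (step v _ r) j = odometer r j ℕ.+ δ v j

  odometer-spec : ∀ {η ξ} (r : Reach η ξ) → ξ ≗ (η ⊖ odometer r)
  odometer-spec {η} (done eq)      i = trans (sym (eq i)) (sym (⊖-zero η i))
  odometer-spec {η} (step v _ r) i = trans (odometer-spec r i) (sym (⊖-fire η (odometer r) v i))

  Reach⇒span : ∀ {η ξ} → Reach η ξ → InSpan Lap_s (λ i → η i - ξ i)
  Reach⇒span {η} r = span-cong Lap_s (λ i → sym (trans (cong (λ t → η i - t) (odometer-spec r i)) (cancel (η i) _)))
                                   (span-⊛ Lap_s (ι (odometer r)))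
    where
    cancel : ∀ a b → a - (a - b) ≡ b
    cancel = solve-∀

  -- Off the diagonal Δ_s is nonpositive, so (Δ_s w)_v ≤ (Δ_s)_{vv} w_v for w ≥ 0.
  Lap_s⊛≤diag : ∀ w v → (Lap_s ⊛ ι w) v ≤ Lap_s v v * + w v
  Lap_s⊛≤diag w v = Σ≤term (λ j → Lap_s v j * + w j) v
    (λ l l≢v → *-nonpos (Lap_s-off≤0 v l (l≢v ∘ sym)) (0≤+ (w l)))

  -- If firing according to w stabilizes η, then every vertex active in η
  -- occurs in w: a vertex that never fires only gains grains.
  active⇒fires : ∀ η w → Stable (η ⊖ w) → ∀ v → Active η v → 1 ℕ.≤ w v
  active⇒fires η w st v act with w v in wv≡
  ... | suc _ = ℕ.s≤s ℕ.z≤n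
  ... | zero  = ⊥-elim (ℤP.<⇒≱ (st v) (ℤP.≤-trans act gains))
    where
    Δv≤0 : (Lap_s ⊛ ι w) v ≤ + 0
    Δv≤0 = ℤP.≤-trans (Lap_s⊛≤diag w v)
             (ℤP.≤-reflexive (trans (cong (λ t → Lap_s v v * + t) wv≡) (ℤP.*-zeroʳ (Lap_s v v))))
    gains : η v ≤ (η ⊖ w) v
    gains = subst (_≤ (η ⊖ w) v) (ℤP.+-identityʳ (η v)) (ℤP.+-monoʳ-≤ (η v) (ℤP.neg-mono-≤ Δv≤0))

  least-action : ∀ {η ξ} (w : Fin m → ℕ) → Stable (η ⊖ w) → (r : Reach η ξ) →
                 ∀ j → odometer r j ℕ.≤ w j
  least-action w st (done _) j = ℕ.z≤n
  least-action {η} w st (step v act r) j =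
    subst (odometer r j ℕ.+ δ v j ℕ.≤_) (w'+δ≡w j) (ℕP.+-monoˡ-≤ (δ v j) (ih j))
    where
    δ≤w : ∀ j → δ v j ℕ.≤ w j
    δ≤w j with v ≟ j
    ... | yes refl = active⇒fires η w st v act
    ... | no  _    = ℕ.z≤n
    w' : Fin m → ℕ
    w' j = w j ℕ.∸ δ v j
    w'+δ≡w : ∀ j → w' j ℕ.+ δ v j ≡ w j
    w'+δ≡w j = ℕP.m∸n+n≡m (δ≤w j)
    same : (η ⊖ w) ≗ (fire v η ⊖ w')
    same i = trans (sym (⊖-cong η w'+δ≡w i)) (⊖-fire η w' v i)
    ih : ∀ j → odometer r j ℕ.≤ w' j
    ih = least-action w' (Stable-cong same st) r

  Stab-unique : ∀ {η ξ ξ'} → Stab η ξ → Stab η ξ' → ξ ≗ ξ'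
  Stab-unique {η} {ξ} {ξ'} (r , st) (r' , st') i = begin
    ξ i                      ≡⟨ odometer-spec r i ⟩
    (η ⊖ odometer r) i       ≡⟨ ⊖-cong η same-odometer i ⟩
    (η ⊖ odometer r') i      ≡⟨ odometer-spec r' i ⟨
    ξ' i                     ∎
    where
    open ≡-Reasoning
    same-odometer : odometer r ≗ odometer r'
    same-odometer j = ℕP.≤-antisym
      (least-action (odometer r') (Stable-cong (odometer-spec r') st') r j)
      (least-action (odometer r) (Stable-cong (odometer-spec r) st) r' j)

  fire-nonneg : ∀ {η} v → Active η v → Nonneg η → Nonneg (fire v η)
  fire-nonneg {η} v act η≥0 i with i ≟ v
  ... | yes refl = ℤP.≤-trans (0≤+ (d (V' v) (V' v)))
        (subst (_≤ η v - Lap_s v v) (trans (cong (λ t → + outdeg d (V' v) - t) (Lap-diag (V' v))) (cancel (+ outdeg d (V' v)) _))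
          (ℤP.+-monoˡ-≤ (- Lap_s v v) act))
    where
    cancel : ∀ a b → a - (a - b) ≡ b
    cancel = solve-∀
  ... | no i≢v = ℤP.≤-trans (η≥0 i)
        (subst (_≤ η i - Lap_s i v) (ℤP.+-identityʳ (η i))
          (ℤP.+-monoʳ-≤ (η i) (ℤP.neg-mono-≤ (Lap_s-off≤0 i v i≢v))))

  Reach-nonneg : ∀ {η ξ} → Reach η ξ → Nonneg η → Nonneg ξ
  Reach-nonneg (done eq)      η≥0 i = subst (+ 0 ≤_) (eq i) (η≥0 i)
  Reach-nonneg (step v act r) η≥0   = Reach-nonneg r (fire-nonneg v act η≥0)

  -- In a strongly connected graph every nonsink vertex has a path to the
  -- sink; along such a path, conservation of grains bounds how often each
  -- vertex can fire without the configuration becoming negative.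
  module Stabilization (sc : StronglyConnected d) where

    length : ∀ {u w} → Path d u w → ℕ
    length here       = 0
    length (step _ p) = suc (length p)

    D : ℤ
    D = + suc (Σℕ (outdeg d))

    D≥0 : + 0 ≤ D
    D≥0 = 0≤+ (suc (Σℕ (outdeg d)))

    diag≤D : ∀ i → Lap_s i i ≤ D
    diag≤D i = begin
      Lap_s i i                               ≡⟨ Lap-diag (V' i) ⟩
      + outdeg d (V' i) - + d (V' i) (V' i)   ≤⟨ ℤP.i-j≤i _ (+ d (V' i) (V' i)) ⟩
      + outdeg d (V' i)                       ≤⟨ ℤ.+≤+ (termℕ≤Σ (outdeg d) (V' i)) ⟩
      + Σℕ (outdeg d)                         ≤⟨ ℤ.+≤+ (ℕP.n≤1+n _) ⟩
      D                                       ∎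
      where open ℤP.≤-Reasoning

    -- Bound on the firings of a vertex at distance k from the sink,
    -- when the configuration initially holds T grains.
    pathBound : ℤ → ℕ → ℤ
    pathBound T zero    = T
    pathBound T (suc k) = T + D * pathBound T k

    pathBound-nonneg : ∀ {T} → + 0 ≤ T → ∀ k → + 0 ≤ pathBound T k
    pathBound-nonneg T≥0 zero    = T≥0
    pathBound-nonneg T≥0 (suc k) = ℤP.≤-trans T≥0 (≤-+nonneg _ (*-nonneg D≥0 (pathBound-nonneg T≥0 k)))

    T≤pathBound : ∀ {T} → + 0 ≤ T → ∀ k → T ≤ pathBound T (suc k)
    T≤pathBound T≥0 k = ≤-+nonneg _ (*-nonneg D≥0 (pathBound-nonneg T≥0 k))

    pathBound-suc : ∀ {T} → + 0 ≤ T → ∀ k → pathBound T k ≤ pathBound T (suc k)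
    pathBound-suc {T} T≥0 k = begin
      pathBound T k              ≡⟨ ℤP.*-identityˡ (pathBound T k) ⟨
      + 1 * pathBound T k        ≤⟨ ℤP.*-monoʳ-≤-nonNeg (pathBound T k) ⦃ ℤ.nonNegative (pathBound-nonneg T≥0 k) ⦄ (ℤ.+≤+ (ℕ.s≤s (ℕ.z≤n {Σℕ (outdeg d)}))) ⟩
      D * pathBound T k          ≤⟨ ℤP.i≤j+i _ T ⦃ ℤ.nonNegative T≥0 ⦄ ⟩
      T + D * pathBound T k      ∎
      where open ℤP.≤-Reasoning

    pathBound-zero : ∀ k → pathBound (+ 0) k ≡ + 0
    pathBound-zero zero    = refl
    pathBound-zero (suc k) = trans (cong (λ t → + 0 + D * t) (pathBound-zero k)) (trans (ℤP.+-identityˡ (D * + 0)) (ℤP.*-zeroʳ D))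

    o≤dd*o : ∀ dd o → 0 ℕ.< dd → + o ≤ + dd * + o
    o≤dd*o (suc dd) o _ = subst (+ o ≤_) (ℤP.pos-* (suc dd) o) (ℤ.+≤+ (ℕP.m≤n*m o (suc dd)))

    module FiringBound (η : Config) (η≥0 : Nonneg η) (o : Fin m → ℕ) (after≥0 : Nonneg (η ⊖ o)) where

      T : ℤ
      T = Σℤ η

      T≥0 : + 0 ≤ T
      T≥0 = Σℤ-nonneg η≥0

      lost : ℤ
      lost = Σℤ (λ j → + d (V' j) s * + o j)

      lost-terms≥0 : ∀ j → + 0 ≤ + d (V' j) s * + o j
      lost-terms≥0 j = *-nonneg (0≤+ (d (V' j) s)) (0≤+ (o j))

      Σ-after : Σℤ (η ⊖ o) ≡ T - lost
      Σ-after = begin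
        Σℤ (η ⊖ o)                                   ≡⟨ Σℤ-- η (Lap_s ⊛ ι o) ⟩
        T - Σℤ (λ i → Σℤ (λ j → Lap_s i j * + o j))  ≡⟨ cong (λ t → T - t) (Σℤ-swap (λ i j → Lap_s i j * + o j)) ⟩
        T - Σℤ (λ j → Σℤ (λ i → Lap_s i j * + o j))  ≡⟨ cong (λ t → T - t) (Σℤ-cong column) ⟩
        T - lost                                     ∎
        where
        open ≡-Reasoning
        column : ∀ j → Σℤ (λ i → Lap_s i j * + o j) ≡ + d (V' j) s * + o j
        column j = trans (Σℤ-*ʳ (λ i → Lap_s i j) (+ o j)) (cong (_* + o j) (Lap_s-colsum j))

      lost≤T : lost ≤ T
      lost≤T = ℤP.0≤i-j⇒j≤i (subst (+ 0 ≤_) Σ-after (Σℤ-nonneg after≥0))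

      after≤T : ∀ i → (η ⊖ o) i ≤ T
      after≤T i = begin
        (η ⊖ o) i      ≤⟨ term≤Σ (η ⊖ o) after≥0 i ⟩
        Σℤ (η ⊖ o)     ≡⟨ Σ-after ⟩
        T - lost       ≤⟨ ℤP.i-j≤i T lost ⦃ ℤ.nonNegative (Σℤ-nonneg lost-terms≥0) ⦄ ⟩
        T              ∎
        where open ℤP.≤-Reasoning

      sink-neighbour : ∀ j → 0 ℕ.< d (V' j) s → + o j ≤ T
      sink-neighbour j pos = begin
        + o j                       ≤⟨ o≤dd*o _ (o j) pos ⟩
        + d (V' j) s * + o j        ≤⟨ term≤Σ _ lost-terms≥0 j ⟩
        lost                        ≤⟨ lost≤T ⟩
        T                           ∎
        where open ℤP.≤-Reasoning

      -- If j sends an edge to i, then j fires at most T + (Δ_s)_{ii} o_i times: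
      -- i cannot receive more grains than T plus what it sends away.
      received : Fin m → Fin m → ℤ
      received i l = - Lap_s i l * + o l

      edge : ∀ i j → i ≢ j → 0 ℕ.< d (V' j) (V' i) → + o j ≤ T + Lap_s i i * + o i
      edge i j i≢j pos = begin
        + o j                                  ≤⟨ o≤dd*o _ (o j) pos ⟩
        + d (V' j) (V' i) * + o j              ≡⟨ cong (_* + o j) (trans (cong -_ (Lap_s-off i j i≢j)) (ℤP.neg-involutive _)) ⟨
        received i j                           ≤⟨ term≤Σ-minus (received i) i j i≢j received≥0 ⟩
        Σℤ (received i) - received i i         ≡⟨ cong₂ _-_ Σ-received refl ⟩
        - (Lap_s ⊛ ι o) i - received i i       ≡⟨ unfold (Lap_s i i) (- (Lap_s ⊛ ι o) i) (+ o i) ⟩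
        - (Lap_s ⊛ ι o) i + Lap_s i i * + o i  ≤⟨ ℤP.+-monoˡ-≤ (Lap_s i i * + o i) inflow≤T ⟩
        T + Lap_s i i * + o i                  ∎
        where
        open ℤP.≤-Reasoning
        received≥0 : ∀ l → l ≢ i → + 0 ≤ received i l
        received≥0 l l≢i = *-nonneg (ℤP.neg-mono-≤ (Lap_s-off≤0 i l (l≢i ∘ sym))) (0≤+ (o l))
        Σ-received : Σℤ (received i) ≡ - (Lap_s ⊛ ι o) i
        Σ-received = trans (Σℤ-cong (λ l → sym (ℤP.neg-distribˡ-* (Lap_s i l) (+ o l))))
                           (Σℤ-neg (λ l → Lap_s i l * + o l))
        unfold : ∀ a b c → b - (- a * c) ≡ b + a * c
        unfold = solve-∀
        inflow≤T : - (Lap_s ⊛ ι o) i ≤ T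
        inflow≤T = begin
          - (Lap_s ⊛ ι o) i          ≡⟨ ℤP.+-identityˡ _ ⟨
          + 0 - (Lap_s ⊛ ι o) i      ≤⟨ ℤP.+-monoˡ-≤ (- (Lap_s ⊛ ι o) i) (η≥0 i) ⟩
          (η ⊖ o) i                  ≤⟨ after≤T i ⟩
          T                          ∎

      along-path : ∀ {u} (p : Path d u s) j → u ≡ V' j → + o j ≤ pathBound T (length p)
      along-path here j u≡V'j = ⊥-elim (V'≢s j (sym u≡V'j))
      along-path (step {v = v} pos rest) j refl with v ≟ s
      ... | yes refl = ℤP.≤-trans (sink-neighbour j pos) (T≤pathBound T≥0 (length rest))
      ... | no  v≢s  with punchOut {i = s} (v≢s ∘ sym) ≟ j
      ...   | yes refl = ℤP.≤-trans (along-path rest _ (sym (FinP.punchIn-punchOut _))) (pathBound-suc T≥0 (length rest))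
      ...   | no  i≢j  = begin
        + o j                          ≤⟨ edge i j i≢j (subst (λ x → 0 ℕ.< d (V' j) x) (sym V'i≡v) pos) ⟩
        T + Lap_s i i * + o i          ≤⟨ ℤP.+-monoʳ-≤ T (ℤP.*-monoʳ-≤-nonNeg (+ o i) (diag≤D i)) ⟩
        T + D * + o i                  ≤⟨ ℤP.+-monoʳ-≤ T (ℤP.*-monoˡ-≤-nonNeg D ⦃ ℤ.nonNegative D≥0 ⦄ ih) ⟩
        T + D * pathBound T (length rest) ∎
        where
        open ℤP.≤-Reasoning
        i : Fin m
        i = punchOut {i = s} (v≢s ∘ sym)
        V'i≡v : V' i ≡ v
        V'i≡v = FinP.punchIn-punchOut _
        ih : + o i ≤ pathBound T (length rest)
        ih = along-path rest i (sym V'i≡v)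

    maxFirings : ℤ → Fin m → ℕ
    maxFirings T j = ℤ.∣ pathBound T (length (sc (V' j) s)) ∣

    firing-bound : ∀ η → Nonneg η → ∀ o → Nonneg (η ⊖ o) → ∀ j → o j ℕ.≤ maxFirings (Σℤ η) j
    firing-bound η η≥0 o after≥0 j = ℤP.drop‿+≤+
      (subst (+ o j ≤_) (sym (ℤP.0≤i⇒+∣i∣≡i (pathBound-nonneg (Σℤ-nonneg η≥0) (length (sc (V' j) s)))))
        (FiringBound.along-path η η≥0 o after≥0 (sc (V' j) s) j refl))

    -- Every nonnegative configuration has a stabilization: firing active
    -- vertices greedily must stop, since the odometer stays below maxFirings.
    -- The fuel counts the firings still possible within that bound.
    stabilize-from : ∀ η → Nonneg η → (fuel : ℕ) (o : Fin m → ℕ) → Nonneg (η ⊖ o) →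
                     Σℕ (maxFirings (Σℤ η)) ℕ.≤ Σℕ o ℕ.+ fuel → Σ Config (Stab (η ⊖ o))
    stabilize-from η η≥0 fuel o after≥0 budget with any? (λ v → + outdeg d (V' v) ℤP.≤? (η ⊖ o) v)
    ... | no none-active = (η ⊖ o) , done (λ i → refl) , (λ v → ℤP.≰⇒> (none-active ∘ (v ,_)))
    ... | yes (v , act)  = fire-and-continue fuel budget
      where
      B : ℕ
      B = Σℕ (maxFirings (Σℤ η))
      o' : Fin m → ℕ
      o' j = o j ℕ.+ δ v j
      after' : (η ⊖ o') ≗ fire v (η ⊖ o)
      after' i = trans (⊖-fire η o v i) (sym (fire-⊖ η o v i))
      after'≥0 : Nonneg (η ⊖ o')
      after'≥0 i = subst (+ 0 ≤_) (sym (after' i)) (fire-nonneg v act after≥0 i)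
      Σo' : Σℕ o' ≡ Σℕ o ℕ.+ 1
      Σo' = trans (Σℕ-+ o (δ v)) (cong (Σℕ o ℕ.+_) (Σℕ-δ v))
      Σo'≤max : Σℕ o ℕ.+ 1 ℕ.≤ B
      Σo'≤max = subst (ℕ._≤ B) Σo' (Σℕ-mono (firing-bound η η≥0 o' after'≥0))
      fire-and-continue : ∀ fuel → B ℕ.≤ Σℕ o ℕ.+ fuel → Σ Config (Stab (η ⊖ o))
      fire-and-continue zero budget = ⊥-elim (ℕP.<⇒≱ (subst (ℕ._≤ B) (ℕP.+-comm (Σℕ o) 1) Σo'≤max)
                                                   (subst (B ℕ.≤_) (ℕP.+-identityʳ (Σℕ o)) budget))
      fire-and-continue (suc fuel) budget
        with stabilize-from η η≥0 fuel o' after'≥0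
               (subst (B ℕ.≤_) (trans (sym (ℕP.+-assoc (Σℕ o) 1 fuel)) (cong (ℕ._+ fuel) (sym Σo'))) budget)
      ... | ξ , r , st = ξ , step v act (Reach-congˡ after' r) , st

    -- Only the specification of the stabilization is ever needed, so its
    -- construction is kept opaque.
    opaque
      stabilize : ∀ η → Nonneg η → Σ Config (Stab η)
      stabilize η η≥0 with stabilize-from η η≥0 (Σℕ (maxFirings (Σℤ η))) (λ _ → 0)
                             (λ i → subst (+ 0 ≤_) (sym (⊖-zero η i)) (η≥0 i))
                             (ℕP.m≤n+m (Σℕ (maxFirings (Σℤ η))) (Σℕ {m} (λ _ → 0)))
      ... | ξ , r , st = ξ , Reach-congˡ (⊖-zero η) r , st

  Reach-iterate : ∀ {x} (e : Fin m → ℕ) → Reach (λ i → x i + + e i) x →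
                  ∀ K → Reach (λ i → x i + + (K ℕ.* e i)) x
  Reach-iterate {x} e r zero    = done (λ i → ℤP.+-identityʳ (x i))
  Reach-iterate {x} e r (suc K) =
    Reach-trans (Reach-congˡ regroup (Reach-shift r (λ i → K ℕ.* e i))) (Reach-iterate e r K)
    where
    regroup : ∀ i → (x i + + e i) + + (K ℕ.* e i) ≡ x i + + (e i ℕ.+ K ℕ.* e i)
    regroup i = trans (ℤP.+-assoc (x i) (+ e i) _) (cong (λ t → x i + t) (sym (ℤP.pos-+ (e i) (K ℕ.* e i))))

  -- Recurrent configurations are nonnegative: they are reachable from 0.
  Recurrent⇒nonneg : ∀ {η} → Recurrent η → Nonneg η
  Recurrent⇒nonneg (_ , acc) with acc (λ _ → + 0)
  ... | c , r = Reach-nonneg r (λ i → subst (+ 0 ≤_) (sym (ℤP.+-identityˡ (+ c i))) (0≤+ (c i)))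

  Recurrent-add : ∀ {η ζ} → Recurrent η → (x : Fin m → ℕ) → Stab (λ i → η i + + x i) ζ → Recurrent ζ
  Recurrent-add {η} {ζ} (_ , acc) x (r , ζ-stable) = ζ-stable , acc'
    where
    acc' : Accessible ζ
    acc' σ with acc σ
    ... | c , rc = (λ i → c i ℕ.+ x i) , Reach-congˡ regroup (Reach-trans (Reach-shift rc x) r)
      where
      regroup : ∀ i → (σ i + + c i) + + x i ≡ σ i + + (c i ℕ.+ x i)
      regroup i = trans (ℤP.+-assoc (σ i) (+ c i) (+ x i)) (cong (λ t → σ i + t) (sym (ℤP.pos-+ (c i) (x i))))

  module Recurrence (sc : StronglyConnected d) where
    open Stabilization sc

    σmax : Config
    σmax i = ℤ.pred (+ outdeg d (V' i))

    stable≤σmax : ∀ {x} → Stable x → ∀ i → x i ≤ σmax i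
    stable≤σmax st i = ℤP.i<j⇒i≤pred[j] (st i)

    -- With d_v grains at every v all vertices are active; the grains lost
    -- on stabilizing form a positive vector ε = Δ_s wε with wε positive.
    loaded : Config
    loaded i = + outdeg d (V' i)

    loaded-stabilization : Σ Config (Stab loaded)
    loaded-stabilization = stabilize loaded (λ i → 0≤+ _)

    settled : Config
    settled = proj₁ loaded-stabilization

    settle : Reach loaded settled
    settle = proj₁ (proj₂ loaded-stabilization)

    wε : Fin m → ℕ
    wε = odometer settle

    wε≥1 : ∀ v → 1 ℕ.≤ wε v
    wε≥1 v = active⇒fires loaded wε (Stable-cong (odometer-spec settle) (proj₂ (proj₂ loaded-stabilization))) v ℤP.≤-refl

    1≤loss : ∀ i → + 1 ≤ loaded i - settled i
    1≤loss i = subst (_≤ loaded i - settled i) (cancel (settled i))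
                 (ℤP.+-monoˡ-≤ (- settled i) (ℤP.i<j⇒suc[i]≤j (proj₂ (proj₂ loaded-stabilization) i)))
      where
      cancel : ∀ a → (+ 1 + a) - a ≡ + 1
      cancel = solve-∀

    ε : Fin m → ℕ
    ε i = ℤ.∣ loaded i - settled i ∣

    ε≡loss : ∀ i → + ε i ≡ loaded i - settled i
    ε≡loss i = ℤP.0≤i⇒+∣i∣≡i (ℤP.≤-trans (0≤+ 1) (1≤loss i))

    ε≥1 : ∀ i → 1 ℕ.≤ ε i
    ε≥1 i = ℤP.drop‿+≤+ (subst (+ 1 ≤_) (sym (ε≡loss i)) (1≤loss i))

    ε≡Δwε : ∀ i → + ε i ≡ (Lap_s ⊛ ι wε) i
    ε≡Δwε i = trans (ε≡loss i) (trans (cong (λ t → loaded i - t) (odometer-spec settle i)) (cancel (loaded i) _))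
      where
      cancel : ∀ a b → a - (a - b) ≡ b
      cancel = solve-∀

    -- σmax + ε →* σmax: shift the stabilization of `loaded` by σmax - settled.
    σmax+ε→σmax : Reach (λ i → σmax i + + ε i) σmax
    σmax+ε→σmax = Reach-congʳ (λ i → trans (cong (λ t → settled i + t) (gap≡ i)) (cancel (settled i) (σmax i)))
                    (Reach-congˡ (λ i → trans (cong (λ t → loaded i + t) (gap≡ i)) (regroup i)) (Reach-shift settle gap))
      where
      gap : Fin m → ℕ
      gap i = ℤ.∣ σmax i - settled i ∣
      gap≡ : ∀ i → + gap i ≡ σmax i - settled i
      gap≡ i = ℤP.0≤i⇒+∣i∣≡i (ℤP.i≤j⇒0≤j-i (stable≤σmax (proj₂ (proj₂ loaded-stabilization)) i))
      cancel : ∀ a b → a + (b - a) ≡ b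
      cancel = solve-∀
      regroup : ∀ i → loaded i + (σmax i - settled i) ≡ σmax i + + ε i
      regroup i = trans (swap (loaded i) (σmax i) (settled i)) (cong (λ t → σmax i + t) (sym (ε≡loss i)))
        where
        swap : ∀ a b c → a + (b - c) ≡ b + (a - c)
        swap = solve-∀

    σmax-recurrent : Recurrent σmax
    σmax-recurrent = (λ i → ℤP.i≤pred[j]⇒i<j ℤP.≤-refl) , reach-σmax
      where
      reach-σmax : Accessible σmax
      reach-σmax σ = c , Reach-congˡ fill (Reach-iterate ε σmax+ε→σmax J)
        where
        J : ℕ
        J = Σℕ (λ j → ℤ.∣ σmax j - σ j ∣)
        c : Fin m → ℕ
        c i = ℤ.∣ (σmax i - σ i) + + (J ℕ.* ε i) ∣
        fill : ∀ i → σmax i + + (J ℕ.* ε i) ≡ σ i + + c i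
        fill i = trans (regroup (σmax i) (σ i) (+ (J ℕ.* ε i)))
                   (cong (λ t → σ i + t) (sym (ℤP.0≤i⇒+∣i∣≡i (nonneg-shift (λ j → σmax j - σ j) ε ε≥1 i))))
          where
          regroup : ∀ a b t → a + t ≡ b + ((a - b) + t)
          regroup = solve-∀

    recurrent-absorbs : ∀ {η} → Recurrent η → Reach (λ i → η i + + ε i) η
    recurrent-absorbs {η} η-rec@(η-stable , η-accessible) with η-accessible σmax
    ... | c , from-σmax with stabilize (λ i → η i + + ε i)
                               (λ i → ℤP.≤-trans (Recurrent⇒nonneg η-rec i) (≤-+nonneg (η i) (0≤+ (ε i))))
    ... | ρ , to-ρ , ρ-stable = Reach-congʳ (sym ∘ η≗ρ) to-ρ
      where
      -- (σmax + c) + ε reaches both η (absorbing ε at σmax first) and ρ.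
      via-σmax : Reach (λ i → (σmax i + + c i) + + ε i) η
      via-σmax = Reach-congˡ (λ i → swap (σmax i) (+ ε i) (+ c i)) (Reach-trans (Reach-shift σmax+ε→σmax c) from-σmax)
        where
        swap : ∀ a b c → (a + b) + c ≡ (a + c) + b
        swap = solve-∀
      via-η : Reach (λ i → (σmax i + + c i) + + ε i) ρ
      via-η = Reach-trans (Reach-shift from-σmax ε) to-ρ
      η≗ρ : η ≗ ρ
      η≗ρ = Stab-unique (via-σmax , η-stable) (via-η , ρ-stable)

    -- If η - ξ ∈ Δ_s ℤ^{n-1} for recurrent η and ξ, then ξ is obtained from η
    -- by "unfiring": ξ = η + Δ_s z with z ≥ 0. Proof: ξ + Kε →* ξ, and η is
    -- ξ + Kε fired according to some W ≥ 0; by least action the legal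
    -- firings to ξ are at most W, and z = W - (those firings).
    Unfires : Config → Config → Set
    Unfires η ξ = Σ (Fin m → ℕ) λ z → ∀ i → ξ i ≡ η i + (Lap_s ⊛ ι z) i

    recurrent-difference : ∀ {η ξ} → Recurrent η → Recurrent ξ → (c : Config) →
      (∀ i → η i - ξ i ≡ (Lap_s ⊛ c) i) → Unfires η ξ
    recurrent-difference {η} {ξ} η-rec ξ-rec c hc = z , ξ≡η+Δz
      where
      K : ℕ
      K = Σℕ (λ j → ℤ.∣ - c j ∣)
      W : Fin m → ℕ
      W j = ℤ.∣ - c j + + (K ℕ.* wε j) ∣
      W≡ : ι W ≗ (λ j → - c j + + (K ℕ.* wε j))
      W≡ j = ℤP.0≤i⇒+∣i∣≡i (nonneg-shift (λ j → - c j) wε wε≥1 j)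
      A : Config
      A i = ξ i + + (K ℕ.* ε i)
      A→ξ : Reach A ξ
      A→ξ = Reach-iterate ε (recurrent-absorbs ξ-rec) K
      ΔW : ∀ i → (Lap_s ⊛ ι W) i ≡ - (η i - ξ i) + + (K ℕ.* ε i)
      ΔW i = begin
        (Lap_s ⊛ ι W) i                                              ≡⟨ ⊛-cong Lap_s W≡ i ⟩
        (Lap_s ⊛ (λ j → - c j + + (K ℕ.* wε j))) i                   ≡⟨ ⊛-+ Lap_s _ _ i ⟩
        (Lap_s ⊛ (λ j → - c j)) i + (Lap_s ⊛ ι (λ j → K ℕ.* wε j)) i ≡⟨ cong₂ _+_ (⊛-neg Lap_s c i) (⊛-cong Lap_s (λ j → ℤP.pos-* K (wε j)) i) ⟩
        - (Lap_s ⊛ c) i + (Lap_s ⊛ (λ j → + K * + wε j)) i           ≡⟨ cong₂ (λ a b → - a + b) (sym (hc i)) (⊛-scale Lap_s (+ K) (ι wε) i) ⟩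
        - (η i - ξ i) + + K * (Lap_s ⊛ ι wε) i                       ≡⟨ cong (λ t → - (η i - ξ i) + + K * t) (ε≡Δwε i) ⟨
        - (η i - ξ i) + + K * + ε i                                  ≡⟨ cong (λ t → - (η i - ξ i) + t) (ℤP.pos-* K (ε i)) ⟨
        - (η i - ξ i) + + (K ℕ.* ε i)                                ∎
        where open ≡-Reasoning
      η≡A⊖W : η ≗ (A ⊖ W)
      η≡A⊖W i = trans (regroup (η i) (ξ i) (+ (K ℕ.* ε i))) (cong (λ t → A i - t) (sym (ΔW i)))
        where
        regroup : ∀ a b k → a ≡ (b + k) - (- (a - b) + k)
        regroup = solve-∀
      o : Fin m → ℕ
      o = odometer A→ξ
      o≤W : ∀ j → o j ℕ.≤ W j
      o≤W = least-action W (Stable-cong η≡A⊖W (proj₁ η-rec)) A→ξ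
      z : Fin m → ℕ
      z j = W j ℕ.∸ o j
      ξ≡η+Δz : ∀ i → ξ i ≡ η i + (Lap_s ⊛ ι z) i
      ξ≡η+Δz i = begin
        ξ i                                                 ≡⟨ odometer-spec A→ξ i ⟩
        A i - (Lap_s ⊛ ι o) i                               ≡⟨ regroup (A i) ((Lap_s ⊛ ι z) i) _ ⟩
        (A i - ((Lap_s ⊛ ι z) i + (Lap_s ⊛ ι o) i)) + (Lap_s ⊛ ι z) i
                                                            ≡⟨ cong (λ t → (A i - t) + (Lap_s ⊛ ι z) i) (⊛-ι-+ Lap_s z o i) ⟨
        (A ⊖ (λ j → z j ℕ.+ o j)) i + (Lap_s ⊛ ι z) i       ≡⟨ cong (_+ (Lap_s ⊛ ι z) i) (⊖-cong A (λ j → ℕP.m∸n+n≡m (o≤W j)) i) ⟩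
        (A ⊖ W) i + (Lap_s ⊛ ι z) i                         ≡⟨ cong (_+ (Lap_s ⊛ ι z) i) (η≡A⊖W i) ⟨
        η i + (Lap_s ⊛ ι z) i                               ∎
        where
        open ≡-Reasoning
        regroup : ∀ a b c → a - c ≡ (a - (b + c)) + b
        regroup = solve-∀

    -- With no grains nothing can fire: if Δ_s w ≤ 0 for w ≥ 0 then w = 0.
    Δs-nonpos⇒zero : ∀ w → Nonneg ((λ _ → + 0) ⊖ w) → ∀ j → w j ≡ 0
    Δs-nonpos⇒zero w after≥0 j = ℕP.n≤0⇒n≡0 (subst (w j ℕ.≤_) no-firings
      (firing-bound (λ _ → + 0) (λ _ → ℤP.≤-refl) w after≥0 j))
      where
      no-firings : maxFirings (Σℤ {m} (λ _ → + 0)) j ≡ 0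
      no-firings = cong ℤ.∣_∣ (trans (cong (λ t → pathBound t (length (sc (V' j) s))) (Σℤ-0 {m}))
                                     (pathBound-zero (length (sc (V' j) s))))

    recurrent-unique : ∀ {η ξ} → Recurrent η → Recurrent ξ → InSpan Lap_s (λ i → η i - ξ i) → η ≗ ξ
    recurrent-unique {η} {ξ} η-rec ξ-rec (c , hc) i = begin
      η i                         ≡⟨ ℤP.+-identityʳ (η i) ⟨
      η i + + 0                   ≡⟨ cong (λ t → η i + t) (trans (⊛-cong Lap_s (λ j → cong +_ (z≡0 j)) i) (⊛-zero Lap_s i)) ⟨
      η i + (Lap_s ⊛ ι z) i       ≡⟨ proj₂ forward i ⟨
      ξ i                         ∎
      where
      open ≡-Reasoning
      forward : Unfires η ξ
      forward = recurrent-difference η-rec ξ-rec c hc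
      backward : Unfires ξ η
      backward = recurrent-difference ξ-rec η-rec (λ j → - c j)
                   (λ i → trans (flip (η i) (ξ i)) (trans (cong -_ (hc i)) (sym (⊛-neg Lap_s c i))))
        where
        flip : ∀ a b → b - a ≡ - (a - b)
        flip = solve-∀
      z z' : Fin m → ℕ
      z = proj₁ forward
      z' = proj₁ backward
      Δ[z+z']≡0 : ∀ i → (Lap_s ⊛ ι (λ j → z j ℕ.+ z' j)) i ≡ + 0
      Δ[z+z']≡0 i = trans (⊛-ι-+ Lap_s z z' i)
                      (cancel (η i) (ξ i) _ _ (proj₂ forward i) (proj₂ backward i))
        where
        cancel : ∀ a b x y → b ≡ a + x → a ≡ b + y → x + y ≡ + 0
        cancel a b x y b≡ a≡ = begin
          x + y                 ≡⟨ expand a x y ⟩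
          ((a + x) + y) - a     ≡⟨ cong (λ t → (t + y) - a) (sym b≡) ⟩
          (b + y) - a           ≡⟨ cong (_- a) (sym a≡) ⟩
          a - a                 ≡⟨ ℤP.+-inverseʳ a ⟩
          + 0                   ∎
          where
          expand : ∀ a x y → x + y ≡ ((a + x) + y) - a
          expand = solve-∀
      z≡0 : ∀ j → z j ≡ 0
      z≡0 j = ℕP.m+n≡0⇒m≡0 (z j) (Δs-nonpos⇒zero (λ j → z j ℕ.+ z' j)
                (λ i → ℤP.≤-reflexive (sym (cong (λ t → + 0 - t) (Δ[z+z']≡0 i)))) j)

    -- Each class of K(G,s) contains a recurrent configuration: add to y a
    -- multiple Kε ∈ Δ_s ℤ^{n-1} so that it exceeds σmax, then stabilize.
    -- Only the specification is used, so the construction is kept opaque.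
    opaque
      recurrent-representative : ∀ (y : Config) → Σ Config λ η → Recurrent η × InSpan Lap_s (λ i → η i - y i)
      recurrent-representative y = η , η-rec , span-cong Lap_s difference
          (span-+ Lap_s (span-neg Lap_s (Reach⇒span to-η)) (span-scale Lap_s (+ K) (span-⊛ Lap_s (ι wε))))
        where
        K : ℕ
        K = Σℕ (λ j → ℤ.∣ y j - σmax j ∣)
        q : Fin m → ℕ
        q i = ℤ.∣ (y i - σmax i) + + (K ℕ.* ε i) ∣
        q≡ : ∀ i → + q i ≡ (y i - σmax i) + + (K ℕ.* ε i)
        q≡ i = ℤP.0≤i⇒+∣i∣≡i (nonneg-shift (λ i → y i - σmax i) ε ε≥1 i)
        p : Config
        p i = σmax i + + q i
        p-stabilization : Σ Config (Stab p)
        p-stabilization = stabilize p (λ i → ℤP.≤-trans (Recurrent⇒nonneg σmax-recurrent i) (≤-+nonneg (σmax i) (0≤+ (q i))))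
        η : Config
        η = proj₁ p-stabilization
        to-η : Reach p η
        to-η = proj₁ (proj₂ p-stabilization)
        η-rec : Recurrent η
        η-rec = Recurrent-add σmax-recurrent q (proj₂ p-stabilization)
        difference : ∀ i → - (p i - η i) + + K * (Lap_s ⊛ ι wε) i ≡ η i - y i
        difference i = begin
          - (p i - η i) + + K * (Lap_s ⊛ ι wε) i                     ≡⟨ cong (λ t → - (p i - η i) + + K * t) (ε≡Δwε i) ⟨
          - (p i - η i) + + K * + ε i                                ≡⟨ cong (λ t → - (p i - η i) + t) (ℤP.pos-* K (ε i)) ⟨
          - ((σmax i + + q i) - η i) + + (K ℕ.* ε i)                 ≡⟨ cong (λ t → - ((σmax i + t) - η i) + + (K ℕ.* ε i)) (q≡ i) ⟩
          - ((σmax i + ((y i - σmax i) + + (K ℕ.* ε i))) - η i) + + (K ℕ.* ε i)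
                                                                     ≡⟨ simplify (σmax i) (y i) (η i) (+ (K ℕ.* ε i)) ⟩
          η i - y i                                                  ∎
          where
          open ≡-Reasoning
          simplify : ∀ a b c t → - ((a + ((b - a) + t)) - c) + t ≡ c - b
          simplify = solve-∀

    module GammaQuotient (γ : Config) (γ-def : IsGamma γ) where

      e : Config
      e = proj₁ γ-def

      e-rec : Recurrent e
      e-rec = proj₁ (proj₂ γ-def)

      e+β→γ : Reach (e ⊞ β) γ
      e+β→γ = proj₁ (proj₂ (proj₂ (proj₂ γ-def)))

      γℕ : Fin m → ℕ
      γℕ i = ℤ.∣ γ i ∣

      γℕ≡γ : ∀ i → + γℕ i ≡ γ i
      γℕ≡γ i = ℤP.0≤i⇒+∣i∣≡i (Reach-nonneg e+β→γ
        (λ i → ℤP.≤-trans (Recurrent⇒nonneg e-rec i) (≤-+nonneg (e i) (0≤+ _))) i)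

      -- γ ≡ β in K(G,s), since e ∈ Δ_s ℤ^{n-1}.
      γ≈β : InSpan Lap_s (λ i → γ i - β i)
      γ≈β = span-cong Lap_s (λ i → simplify (e i) (β i) (γ i))
              (span-+ Lap_s (proj₁ (proj₂ (proj₂ γ-def))) (span-neg Lap_s (Reach⇒span e+β→γ)))
        where
        simplify : ∀ a b c → a + - ((a + b) - c) ≡ c - b
        simplify = solve-∀

      AddPow⇒span : ∀ {k x y} → AddPow γ k x y → InSpan Lap_s (λ i → (y i - x i) - + k * β i)
      AddPow⇒span {zero} {x} {y} (pow0 x≗y) =
        span-cong Lap_s (λ i → sym (trans (cong (λ t → (y i - t) - + 0 * β i) (x≗y i)) (cancel (y i) (β i)))) (span-0 Lap_s)
        where
        cancel : ∀ a b → (a - a) - + 0 * b ≡ + 0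
        cancel = solve-∀
      AddPow⇒span {suc k} {x} {y} (powS {η' = x'} (r , _) rest) =
        span-cong Lap_s (λ i → trans (regroup (y i) (x i) (x' i) (γ i) (β i) (+ k))
                                     (cong (λ t → (y i - x i) - t * β i) (sym (ℤP.pos-+ 1 k))))
          (span-+ Lap_s (span-+ Lap_s (AddPow⇒span rest) (span-neg Lap_s (Reach⇒span r))) γ≈β)
        where
        regroup : ∀ y x x' g b k → (((y - x') - k * b) + - ((x + g) - x')) + (g - b) ≡ (y - x) - (+ 1 + k) * b
        regroup = solve-∀

      AddPow-congʳ : ∀ {k x y y'} → AddPow γ k x y → y ≗ y' → AddPow γ k x y'
      AddPow-congʳ (pow0 eq)      e' = pow0 (λ i → trans (eq i) (e' i))
      AddPow-congʳ (powS st rest) e' = powS st (AddPow-congʳ rest e')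

      add-powers : ∀ k {x} → Recurrent x → Σ Config λ y → Recurrent y × AddPow γ k x y
      add-powers zero {x} x-rec = x , x-rec , pow0 (λ i → refl)
      add-powers (suc k) {x} x-rec
        with stabilize (λ i → x i + + γℕ i) (λ i → ℤP.≤-trans (Recurrent⇒nonneg x-rec i) (≤-+nonneg (x i) (0≤+ (γℕ i))))
      ... | x' , r , x'-stable with add-powers k (Recurrent-add x-rec γℕ (r , x'-stable))
      ... | y , y-rec , pow = y , y-rec , powS (Reach-congˡ (λ i → cong (λ t → x i + t) (γℕ≡γ i)) r , x'-stable) pow

      ι-Rec : Rec → Config
      ι-Rec = proj₁

      ι-Rec-wd : ∀ x y → x ~γ y [ γ ] → ι-Rec x ≈Kβ ι-Rec y
      ι-Rec-wd _ _ (k , inj₁ pow) = + k , AddPow⇒span pow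
      ι-Rec-wd (η , _) (ξ , _) (k , inj₂ pow) =
        - + k , span-cong Lap_s (λ i → flip (ξ i) (η i) (+ k) (β i)) (span-neg Lap_s (AddPow⇒span pow))
        where
        flip : ∀ a b k c → - ((a - b) - k * c) ≡ (b - a) - (- k) * c
        flip = solve-∀

      ι-Rec-inj : ∀ x y → ι-Rec x ≈Kβ ι-Rec y → x ~γ y [ γ ]
      ι-Rec-inj (η , η-rec) (ξ , ξ-rec) (+ j , hspan) with add-powers j ξ-rec
      ... | y , y-rec , pow = j , inj₁ (AddPow-congʳ pow (recurrent-unique y-rec η-rec
            (span-cong Lap_s (λ i → simplify (y i) (ξ i) (η i) (+ j * β i)) (span-+ Lap_s (AddPow⇒span pow) (span-neg Lap_s hspan)))))
        where
        simplify : ∀ y x n t → ((y - x) - t) + - ((n - x) - t) ≡ y - n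
        simplify = solve-∀
      ι-Rec-inj (η , η-rec) (ξ , ξ-rec) (ℤ.-[1+ j ] , hspan) with add-powers (suc j) η-rec
      ... | y , y-rec , pow = suc j , inj₂ (AddPow-congʳ pow (recurrent-unique y-rec ξ-rec
            (span-cong Lap_s (λ i → simplify (y i) (ξ i) (η i) (+ suc j) (β i)) (span-+ Lap_s (AddPow⇒span pow) hspan))))
        where
        simplify : ∀ y x n k b → ((y - n) - k * b) + ((n - x) - (- k) * b) ≡ y - x
        simplify = solve-∀

      ι-Rec-surj : ∀ y → Σ Rec λ x → ι-Rec x ≈Kβ y
      ι-Rec-surj y with recurrent-representative y
      ... | η , η-rec , hspan = (η , η-rec) , + 0 , span-cong Lap_s (λ i → sym (ℤP.+-identityʳ (η i - y i))) hspan

      ι-Rec-hom : ∀ (η ξ ζ : Rec) → Stab (proj₁ η ⊞ proj₁ ξ) (proj₁ ζ) → ι-Rec ζ ≈Kβ (ι-Rec η ⊞ ι-Rec ξ)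
      ι-Rec-hom (η , _) (ξ , _) (ζ , _) (r , _) =
        + 0 , span-cong Lap_s (λ i → flip (η i + ξ i) (ζ i) (β i)) (span-neg Lap_s (Reach⇒span r))
        where
        flip : ∀ a b c → - (a - b) ≡ (b - a) - + 0 * c
        flip = solve-∀

      ι-Rec-iso : IsQuotBij (λ η ξ → η ~γ ξ [ γ ]) _≈Kβ_ ι-Rec
      ι-Rec-iso = record { wd = ι-Rec-wd ; inj = ι-Rec-inj ; surj = ι-Rec-surj }

  module BetaQuotient where
    open Total d

    extend : ℤ → Config → Fin (suc m) → ℤ
    extend a x v with s ≟ v
    ... | yes _   = a
    ... | no  s≢v = x (punchOut s≢v)

    extend-s : ∀ a x → extend a x s ≡ a
    extend-s a x with s ≟ s
    ... | yes _  = refl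
    ... | no s≢s = ⊥-elim (s≢s refl)

    extend-V' : ∀ a x i → extend a x (V' i) ≡ x i
    extend-V' a x i with s ≟ V' i
    ... | yes s≡V'i = ⊥-elim (V'≢s i (sym s≡V'i))
    ... | no  _     = cong x (trans (FinP.punchOut-cong s refl) (FinP.punchOut-punchIn s))

    by-cases : ∀ {P : Fin (suc m) → Set} → P s → (∀ i → P (V' i)) → ∀ v → P v
    by-cases {P} ps pV' v with s ≟ v
    ... | yes refl = ps
    ... | no  s≢v  = subst P (FinP.punchIn-punchOut s≢v) (pV' (punchOut s≢v))

    Lap⊛-V' : ∀ C i → (Lap d ⊛ C) (V' i) ≡ - β i * C s + (Lap_s ⊛ (C ∘ V')) i
    Lap⊛-V' C i = trans (Σℤ-split s (λ w → Lap d (V' i) w * C w))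
                        (cong (λ t → t * C s + (Lap_s ⊛ (C ∘ V')) i) (Lap-off (V' i) s (V'≢s i)))

    Z0-at-s : ∀ (f : Fin (suc m) → ℤ) → Σℤ f ≡ + 0 → f s ≡ - Σℤ (f ∘ V')
    Z0-at-s f Σf≡0 = ℤ-inverseˡ-unique (f s) (Σℤ (f ∘ V')) (trans (sym (Σℤ-split s f)) Σf≡0)

    lift : Config → Fin (suc m) → ℤ
    lift x = extend (- Σℤ x) x

    Σ-lift : ∀ x → Σℤ (lift x) ≡ + 0
    Σ-lift x = trans (Σℤ-split s (lift x))
                 (trans (cong₂ _+_ (extend-s (- Σℤ x) x) (Σℤ-cong (extend-V' (- Σℤ x) x)))
                        (ℤP.+-inverseˡ (Σℤ x)))

    lift₀ : Config → Z0
    lift₀ x = lift x , Σ-lift x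

    ≗⇒≈Δ : ∀ {x y} → x ≗ y → x ≈Δ y
    ≗⇒≈Δ {x} {y} x≗y = span-cong (Lap d) (λ v → sym (trans (cong (_- y v) (x≗y v)) (ℤP.+-inverseʳ (y v)))) (span-0 (Lap d))

    lift-wd : ∀ x y → x ≈Kβ y → lift₀ x ≈Z0 lift₀ y
    lift-wd x y (k , c , hc) = C , by-cases {λ v → lift x v - lift y v ≡ (Lap d ⊛ C) v} at-s at-V'
      where
      C : Fin (suc m) → ℤ
      C = extend (- k) c
      at-V' : ∀ i → lift x (V' i) - lift y (V' i) ≡ (Lap d ⊛ C) (V' i)
      at-V' i = sym (begin
        (Lap d ⊛ C) (V' i)                       ≡⟨ Lap⊛-V' C i ⟩
        - β i * C s + (Lap_s ⊛ (C ∘ V')) i       ≡⟨ cong₂ (λ a b → - β i * a + b) (extend-s (- k) c) (⊛-cong Lap_s (extend-V' (- k) c) i) ⟩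
        - β i * - k + (Lap_s ⊛ c) i              ≡⟨ cong (λ t → - β i * - k + t) (hc i) ⟨
        - β i * - k + ((x i - y i) - k * β i)    ≡⟨ cancel (x i) (y i) k (β i) ⟩
        x i - y i                                ≡⟨ cong₂ _-_ (extend-V' _ x i) (extend-V' _ y i) ⟨
        lift x (V' i) - lift y (V' i)            ∎)
        where
        open ≡-Reasoning
        cancel : ∀ x y k b → - b * - k + ((x - y) - k * b) ≡ x - y
        cancel = solve-∀
      at-s : lift x s - lift y s ≡ (Lap d ⊛ C) s
      at-s = sym (begin
        (Lap d ⊛ C) s                                  ≡⟨ Z0-at-s (Lap d ⊛ C) (Σ-Lap⊛ C) ⟩
        - Σℤ (λ i → (Lap d ⊛ C) (V' i))                ≡⟨ cong -_ (Σℤ-cong (λ i → sym (at-V' i))) ⟩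
        - Σℤ (λ i → lift x (V' i) - lift y (V' i))     ≡⟨ cong -_ (Σℤ-cong (λ i → cong₂ _-_ (extend-V' _ x i) (extend-V' _ y i))) ⟩
        - Σℤ (λ i → x i - y i)                         ≡⟨ cong -_ (Σℤ-- x y) ⟩
        - (Σℤ x - Σℤ y)                                ≡⟨ ℤP.neg-distrib-+ (Σℤ x) (- Σℤ y) ⟩
        - Σℤ x - - Σℤ y                                ≡⟨ cong₂ _-_ (extend-s _ x) (extend-s _ y) ⟨
        lift x s - lift y s                            ∎)
        where open ≡-Reasoning

    lift-inj : ∀ x y → lift₀ x ≈Z0 lift₀ y → x ≈Kβ y
    lift-inj x y (C , hC) = - C s , C ∘ V' , λ i → begin
      (x i - y i) - - C s * β i                        ≡⟨ cong (λ t → t - - C s * β i) (cong₂ _-_ (extend-V' _ x i) (extend-V' _ y i)) ⟨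
      (lift x (V' i) - lift y (V' i)) - - C s * β i    ≡⟨ cong (λ t → t - - C s * β i) (trans (hC (V' i)) (Lap⊛-V' C i)) ⟩
      (- β i * C s + (Lap_s ⊛ (C ∘ V')) i) - - C s * β i ≡⟨ cancel (β i) (C s) _ ⟩
      (Lap_s ⊛ (C ∘ V')) i                             ∎
      where
      open ≡-Reasoning
      cancel : ∀ b c l → (- b * c + l) - - c * b ≡ l
      cancel = solve-∀

    lift-surj : ∀ (z : Z0) → Σ Config λ x → lift₀ x ≈Z0 z
    lift-surj (z , Σz≡0) = z ∘ V' , ≗⇒≈Δ (by-cases {λ v → lift (z ∘ V') v ≡ z v} at-s (extend-V' _ (z ∘ V')))
      where
      at-s : lift (z ∘ V') s ≡ z s
      at-s = trans (extend-s _ (z ∘ V')) (sym (Z0-at-s z Σz≡0))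

    lift₀-iso : IsQuotBij _≈Kβ_ _≈Z0_ lift₀
    lift₀-iso = record { wd = lift-wd ; inj = lift-inj ; surj = lift-surj }

    lift-hom : ∀ x y → lift (x ⊞ y) ≈Δ (λ v → lift x v + lift y v)
    lift-hom x y = ≗⇒≈Δ (by-cases {λ v → lift (x ⊞ y) v ≡ lift x v + lift y v} at-s at-V')
      where
      at-V' : ∀ i → lift (x ⊞ y) (V' i) ≡ lift x (V' i) + lift y (V' i)
      at-V' i = trans (extend-V' _ (x ⊞ y) i) (sym (cong₂ _+_ (extend-V' _ x i) (extend-V' _ y i)))
      at-s : lift (x ⊞ y) s ≡ lift x s + lift y s
      at-s = trans (extend-s _ (x ⊞ y)) (trans (cong -_ (Σℤ-+ x y))
               (trans (ℤP.neg-distrib-+ (Σℤ x) (Σℤ y)) (sym (cong₂ _+_ (extend-s _ x) (extend-s _ y)))))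

theorem2p10 : (m : ℕ) (d : Multigraph (suc m)) → StronglyConnected d → (s : Fin (suc m)) →
    let open Sandpile d s
        open Total d
    in (γ : Config) → IsGamma γ →
       (Σ (Rec → Config) λ f →
          IsQuotBij (λ η ξ → η ~γ ξ [ γ ]) _≈Kβ_ f
          × (∀ (η ξ ζ : Rec) → Stab (proj₁ η ⊞ proj₁ ξ) (proj₁ ζ) → f ζ ≈Kβ (f η ⊞ f ξ)))
       × (Σ (Config → Z0) λ g →
          IsQuotBij _≈Kβ_ _≈Z0_ g
          × (∀ (x y : Config) → proj₁ (g (x ⊞ y)) ≈Δ (λ i → proj₁ (g x) i + proj₁ (g y) i)))
theorem2p10 m d sc s γ γ-def =
    (ι-Rec , ι-Rec-iso , ι-Rec-hom)
  , (lift₀ , lift₀-iso , lift-hom)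
  where
  open SandpileTheory d s
  open Recurrence sc
  open GammaQuotient γ γ-def
  open BetaQuotient
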